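{- Let $k$ be a positive integer, let $a\ge k+2$ and $G=K_a\,\Box\,K_a$. Then $\gamma_{P,k}(G-e)=a-k-1$ for every edge $e$ of $G$.
   Context: $K_a$ is the complete graph on $a$ vertices and $\Box$ denotes the Cartesian product: $V(G\Box H)=V(G)\times V(H)$, with $(g,h)$ adjacent to $(g',h')$ iff either $g=g'$ and $hh'\in E(H)$, or $h=h'$ and $gg'\in E(G)$. $G-e$ is obtained by deleting the edge $e$. $N_G[v]$ is the closed neighbourhood of $v$ and $N_G[S]=\bigcup_{v\in S}N_G[v]$. For $S\subseteq V(G)$, define $\mathcal{P}^{0}_{G,k}(S)=N_G[S]$ and $\mathcal{P}^{t+1}_{G,k}(S)=\bigcup\{N_G[u] : u\in \mathcal{P}^{t}_{G,k}(S),\ |N_G[u]\setminus \mathcal{P}^{t}_{G,k}(S)|\le k\}$; these sets increase and stabilize to $\mathcal{P}^{\infty}_{G,k}(S)$. $S$ is a $k$-power dominating set if $\mathcal{P}^{\infty}_{G,k}(S)=V(G)$; $\gamma_{P,k}(G)$ is the minimum size of such a set. -}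

module Defs where

open import Data.Nat using (ℕ; zero; suc; _*_; _≤_; _≤ᵇ_)
open import Data.Bool using (Bool; true; false; _∧_; _∨_; not)
open import Data.Fin using (Fin; remQuot)
open import Data.Fin.Properties using (_≟_)
open import Data.Fin.Subset using (Subset; ∣_∣; _∩_; ∁; _∈_; ⊤)
open import Data.Vec using (tabulate; lookup)
open import Data.List using (allFin)
open import Data.Bool.ListAction using (any)
open import Data.Product using (_×_; _,_; Σ; ∃)
open import Relation.Nullary.Decidable using (⌊_⌋)
open import Relation.Binary.PropositionalEquality using (_≡_)

-- A (finite, simple, loopless) graph on vertex set Fin n, given by a
-- Boolean adjacency function.  (Symmetry/irreflexivity hold for all the
-- concrete graphs below by construction.)
record Graph : Set where
  field
    order : ℕ
    adj   : Fin order → Fin order → Bool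
open Graph public

eqᵇ : ∀ {n} → Fin n → Fin n → Bool
eqᵇ i j = ⌊ i ≟ j ⌋

K : ℕ → Graph
K a = record { order = a ; adj = λ i j → not (eqᵇ i j) }

-- Cartesian product G □ H; vertex (g , h) is encoded in Fin (|G| * |H|)
-- via Data.Fin.remQuot / combine.
_□_ : Graph → Graph → Graph
G □ H = record { order = order G * order H ; adj = ad }
  where
  ad : Fin (order G * order H) → Fin (order G * order H) → Bool
  ad x y with remQuot (order H) x | remQuot (order H) y
  ... | g , h | g' , h' =
        (eqᵇ g g' ∧ adj H h h') ∨ (eqᵇ h h' ∧ adj G g g')

Edge : Graph → Set
Edge G = Σ (Fin (order G)) λ u → Σ (Fin (order G)) λ v → adj G u v ≡ true

_─_ : (G : Graph) → Edge G → Graph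
G ─ (u , v , _) = record { order = order G ; adj = ad }
  where
  ad : Fin (order G) → Fin (order G) → Bool
  ad x y = adj G x y ∧ not ((eqᵇ x u ∧ eqᵇ y v) ∨ (eqᵇ x v ∧ eqᵇ y u))

module _ (G : Graph) where
  private
    n = order G

  anyV : (Fin n → Bool) → Bool
  anyV p = any p (allFin n)

  N[_] : Fin n → Subset n
  N[ v ] = tabulate λ w → eqᵇ w v ∨ adj G v w

  N[_]ˢ : Subset n → Subset n
  N[ S ]ˢ = tabulate λ w → anyV λ v → lookup S v ∧ lookup N[ v ] w

  step : ℕ → Subset n → Subset n
  step k P = tabulate λ w → anyV λ u →
    lookup P u ∧ (∣ N[ u ] ∩ ∁ P ∣ ≤ᵇ k) ∧ lookup N[ u ] w

  𝒫 : ℕ → ℕ → Subset n → Subset n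
  𝒫 k zero    S = N[ S ]ˢ
  𝒫 k (suc t) S = step k (𝒫 k t S)

  -- S is k-power dominating: 𝒫^∞ = V(G).  Since the 𝒫^t increase and
  -- stabilise, 𝒫^∞ = V(G) iff 𝒫^t = V(G) for some t.
  IsKPowerDominating : ℕ → Subset n → Set
  IsKPowerDominating k S = ∃ λ t → 𝒫 k t S ≡ ⊤

  PowerDominationNumberIs : ℕ → ℕ → Set
  PowerDominationNumberIs k m =
    (Σ (Subset n) λ S → IsKPowerDominating k S × ∣ S ∣ ≡ m)
    × (∀ (S : Subset n) → IsKPowerDominating k S → m ≤ ∣ S ∣)

-- Vertices of K_a □ K_a are cells ⟨ row , col ⟩, adjacent when they share exactly one
-- coordinate. Its automorphisms act transitively on edges, so it suffices to delete the
-- edge ⟨0,0⟩⟨0,1⟩. With m = a − k − 1, the diagonal cells ⟨i,i⟩, 1 ≤ i ≤ m, observe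
-- every row and column in {1, …, m}; then ⟨0,1⟩ forces the rest of row 0, each ⟨1,h⟩
-- with h ≠ 0 forces column h (both with exactly k unobserved neighbours), and each
-- ⟨g,2⟩ forces its row, where only ⟨g,0⟩ can be missing. Conversely, if |S| < m, the
-- cells on a row or column meeting S are closed under propagation: a vertex whose row
-- misses S sees at least a − |S| − 1 > k unobserved neighbours on that row, the deleted
-- edge costing at most one, and likewise for columns. Fewer than a rows meet S, so
-- some cell is never observed.

module Submission where

open import Defs
open import Data.Bool using (Bool; true; false; _∧_; _∨_; not; if_then_else_; T)
open import Data.Bool.Properties using (∧-conicalˡ; ∧-conicalʳ; ∨-conicalˡ; ∨-conicalʳ; ∨-comm; ∨-zeroʳ; ¬-not; not-injective; not-involutive; T-≡)
open import Data.Bool.ListAction using (any; or)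
open import Data.List using (allFin)
open import Data.List.Properties using (map-cong)
open import Data.List.Relation.Unary.Any using (satisfied)
open import Data.List.Relation.Unary.Any.Properties using (any⁺; any⁻)
open import Data.List.Membership.Propositional using (lose)
open import Data.List.Membership.Propositional.Properties using (∈-allFin)
open import Function.Bundles using (Equivalence)
open import Relation.Nullary using (Dec; yes; no; contradiction; ¬_; _×-dec_; _⊎-dec_)
open import Data.Nat using (ℕ; zero; suc; _≤_; _<_; _+_; _∸_; _*_; z≤n; s≤s; _<ᵇ_; _≤ᵇ_)
import Data.Nat.Properties as ℕ
import Data.Fin.Properties as Fin
open import Data.Fin using (Fin; zero; suc; toℕ; combine; remQuot; _↑ˡ_; _↑ʳ_)
open import Data.Fin.Permutation using (Permutation; _⟨$⟩ʳ_; _⟨$⟩ˡ_; inverseˡ; inverseʳ; flip; _∘ₚ_; transpose; permutation)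
open import Data.Fin.Subset using (Subset; ∣_∣; _∩_; ∁; ⊤; inside; outside)
open import Data.Fin.Properties using (_≟_)
open import Data.Vec using ([]; _∷_; tabulate; lookup)
open import Data.Vec.Properties using (lookup∘tabulate; lookup-zipWith; lookup-map; lookup-replicate)
open import Data.Product using (_×_; _,_; ∃; Σ; proj₁; proj₂)
open import Function using (_∘_; case_of_)
open import Data.Empty using (⊥; ⊥-elim)
open import Relation.Binary.PropositionalEquality
open import Data.Sum using (_⊎_; inj₁; inj₂; [_,_]′)
open import Algebra.Properties.CommutativeMonoid.Sum ℕ.+-0-commutativeMonoid
  using (sum; sum-syntax; sum-cong-≗; sum-permute)

T⇒≡ : ∀ {b} → T b → b ≡ true
T⇒≡ = Equivalence.to T-≡

≡⇒T : ∀ {b} → b ≡ true → T b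
≡⇒T = Equivalence.from T-≡

∧-true⁻ : ∀ a {b} → a ∧ b ≡ true → a ≡ true × b ≡ true
∧-true⁻ a {b} p = ∧-conicalˡ a b p , ∧-conicalʳ a b p

∨-true⁻ : ∀ a {b} → a ∨ b ≡ true → a ≡ true ⊎ b ≡ true
∨-true⁻ true _ = inj₁ refl
∨-true⁻ false b≡true = inj₂ b≡true

not-true⇒false : ∀ {b} → not b ≡ true → b ≡ false
not-true⇒false {false} _ = refl

not-antitone : ∀ {b c} → (b ≡ true → c ≡ true) → not c ≡ true → not b ≡ true
not-antitone {false} _ _ = refl
not-antitone {true} b⇒c nc rewrite b⇒c refl = nc

eqᵇ-refl : ∀ {n} (i : Fin n) → eqᵇ i i ≡ true
eqᵇ-refl i with i ≟ i
... | yes _ = refl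
... | no i≢i = contradiction refl i≢i

eqᵇ⇒≡ : ∀ {n} {i j : Fin n} → eqᵇ i j ≡ true → i ≡ j
eqᵇ⇒≡ {i = i} {j} _ with i ≟ j
... | yes i≡j = i≡j

not-eqᵇ⇒≢ : ∀ {n} {i j : Fin n} → not (eqᵇ i j) ≡ true → i ≢ j
not-eqᵇ⇒≢ {i = i} p refl with () ← trans (sym p) (cong not (eqᵇ-refl i))

eqᵇ-injective : ∀ {m n} (f : Fin m → Fin n) → (∀ {x y} → f x ≡ f y → x ≡ y) →
  ∀ x y → eqᵇ (f x) (f y) ≡ eqᵇ x y
eqᵇ-injective f f-inj x y with x ≟ y | f x ≟ f y
... | yes refl | yes _ = refl
... | yes refl | no fx≢fx = contradiction refl fx≢fx
... | no x≢y | yes fx≡fy = contradiction (f-inj fx≡fy) x≢y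
... | no _ | no _ = refl

⟨$⟩ʳ-injective : ∀ {m n} (π : Permutation m n) {x y} → π ⟨$⟩ʳ x ≡ π ⟨$⟩ʳ y → x ≡ y
⟨$⟩ʳ-injective π {x} {y} eq = begin
  x                       ≡⟨ inverseˡ π ⟨
  π ⟨$⟩ˡ (π ⟨$⟩ʳ x)       ≡⟨ cong (π ⟨$⟩ˡ_) eq ⟩
  π ⟨$⟩ˡ (π ⟨$⟩ʳ y)       ≡⟨ inverseˡ π ⟩
  y                       ∎
  where open ≡-Reasoning

lookup-⊤ : ∀ {n} (i : Fin n) → lookup ⊤ i ≡ true
lookup-⊤ i = lookup-replicate i true

all-inside⇒≡⊤ : ∀ {n} (p : Subset n) → (∀ i → lookup p i ≡ true) → p ≡ ⊤
all-inside⇒≡⊤ [] _ = refl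
all-inside⇒≡⊤ (x ∷ p) all = cong₂ _∷_ (all zero) (all-inside⇒≡⊤ p (all ∘ suc))

-- Counting

ind : Bool → ℕ
ind b = if b then 1 else 0

count : ∀ {n} → (Fin n → Bool) → ℕ
count f = sum (ind ∘ f)

_⊆ᵇ_ : ∀ {n} → (Fin n → Bool) → (Fin n → Bool) → Set
f ⊆ᵇ g = ∀ i → f i ≡ true → g i ≡ true

∨-⊆ᵇ : ∀ {n} {f g h : Fin n → Bool} → f ⊆ᵇ h → g ⊆ᵇ h → (λ i → f i ∨ g i) ⊆ᵇ h
∨-⊆ᵇ {f = f} f⊆h g⊆h i p = [ f⊆h i , g⊆h i ]′ (∨-true⁻ (f i) p)

AtMostOne : ∀ {n} → (Fin n → Bool) → Set
AtMostOne f = ∀ i j → f i ≡ true → f j ≡ true → i ≡ j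

count-cong : ∀ {n} {f g : Fin n → Bool} → (∀ i → f i ≡ g i) → count f ≡ count g
count-cong f≗g = sum-cong-≗ (cong ind ∘ f≗g)

∣p∣≡count : ∀ {n} (p : Subset n) → ∣ p ∣ ≡ count (lookup p)
∣p∣≡count [] = refl
∣p∣≡count (outside ∷ p) = ∣p∣≡count p
∣p∣≡count (inside ∷ p) = cong suc (∣p∣≡count p)

∣tabulate∣≡count : ∀ {n} (f : Fin n → Bool) → ∣ tabulate f ∣ ≡ count f
∣tabulate∣≡count f = trans (∣p∣≡count (tabulate f)) (count-cong (lookup∘tabulate f))

count-permute : ∀ {m n} (π : Permutation m n) (f : Fin n → Bool) → count (f ∘ (π ⟨$⟩ʳ_)) ≡ count f
count-permute π f = sym (sum-permute (ind ∘ f) π)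

sum-mono : ∀ {n} {f g : Fin n → ℕ} → (∀ i → f i ≤ g i) → sum f ≤ sum g
sum-mono {zero} _ = z≤n
sum-mono {suc n} f≤g = ℕ.+-mono-≤ (f≤g zero) (sum-mono (f≤g ∘ suc))

sum-term : ∀ {n} (f : Fin n → ℕ) i → f i ≤ sum f
sum-term f zero = ℕ.m≤m+n _ _
sum-term f (suc i) = ℕ.≤-trans (sum-term (f ∘ suc) i) (ℕ.m≤n+m _ _)

sum-↑ : ∀ m {n} (f : Fin (m + n) → ℕ) → sum f ≡ sum (f ∘ (_↑ˡ n)) + sum (f ∘ (m ↑ʳ_))
sum-↑ zero f = refl
sum-↑ (suc m) f = trans (cong (f zero +_) (sum-↑ m (f ∘ suc))) (sym (ℕ.+-assoc (f zero) _ _))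

sum-combine : ∀ m {n} (f : Fin (m * n) → ℕ) → sum f ≡ ∑[ i < m ] ∑[ j < n ] f (combine i j)
sum-combine zero f = refl
sum-combine (suc m) {n} f =
  trans (sum-↑ n f) (cong (sum (f ∘ (_↑ˡ m * n)) +_) (sum-combine m (f ∘ (n ↑ʳ_))))

count-combine : ∀ {m n} (f : Fin (m * n) → Bool) → count f ≡ ∑[ i < m ] count (λ j → f (combine i j))
count-combine {m} f = sum-combine m (ind ∘ f)

ind-mono : ∀ {b c} → (b ≡ true → c ≡ true) → ind b ≤ ind c
ind-mono {false} _ = z≤n
ind-mono {true} b⇒c rewrite b⇒c refl = ℕ.≤-refl

count-mono : ∀ {n} {f g : Fin n → Bool} → f ⊆ᵇ g → count f ≤ count g
count-mono f⊆g = sum-mono (λ i → ind-mono (f⊆g i))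

count-term : ∀ {n} (f : Fin n → Bool) i → ind (f i) ≤ count f
count-term f = sum-term (ind ∘ f)

sum≤single : ∀ {n} (f : Fin n → ℕ) i → (∀ j → j ≢ i → f j ≡ 0) → sum f ≤ f i
sum≤single f zero others = ℕ.≤-reflexive (trans (cong (f zero +_) (sum-zero (f ∘ suc) (λ j → others (suc j) λ ()))) (ℕ.+-identityʳ _))
  where
  sum-zero : ∀ {n} (g : Fin n → ℕ) → (∀ j → g j ≡ 0) → sum g ≡ 0
  sum-zero {zero} g _ = refl
  sum-zero {suc n} g g≡0 rewrite g≡0 zero = sum-zero (g ∘ suc) (g≡0 ∘ suc)
sum≤single f (suc i) others rewrite others zero (λ ()) =
  sum≤single (f ∘ suc) i (λ j j≢i → others (suc j) (j≢i ∘ Fin.suc-injective))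

count-zero : ∀ {n} (f : Fin n → Bool) → (∀ i → f i ≡ false) → count f ≡ 0
count-zero {zero} f _ = refl
count-zero {suc n} f f≡false rewrite f≡false zero = count-zero (f ∘ suc) (f≡false ∘ suc)

count+count-not : ∀ {n} (f : Fin n → Bool) → count f + count (not ∘ f) ≡ n
count+count-not {zero} f = refl
count+count-not {suc n} f with f zero | count+count-not (f ∘ suc)
... | true | eq = cong suc eq
... | false | eq = trans (ℕ.+-suc (count (f ∘ suc)) _) (cong suc eq)

count≤1 : ∀ {n} (f : Fin n → Bool) → AtMostOne f → count f ≤ 1
count≤1 {zero} f _ = z≤n
count≤1 {suc n} f unique with f zero in f0
... | true = ℕ.≤-reflexive (cong suc (count-zero (f ∘ suc) rest-false))
  where
  rest-false : ∀ i → f (suc i) ≡ false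
  rest-false i with f (suc i) in fi
  ... | false = refl
  ... | true with () ← unique zero (suc i) f0 fi
... | false = count≤1 (f ∘ suc) (λ i j fi fj → Fin.suc-injective (unique (suc i) (suc j) fi fj))

count<n⇒false : ∀ {n} (f : Fin n → Bool) → count f < n → ∃ λ i → f i ≡ false
count<n⇒false {suc n} f lt with f zero in f0
... | false = zero , f0
... | true with count<n⇒false (f ∘ suc) (ℕ.≤-pred lt)
... | i , fi = suc i , fi

count≤count-∧-not+count : ∀ {n} (f g : Fin n → Bool) → count f ≤ count (λ i → f i ∧ not (g i)) + count g
count≤count-∧-not+count {zero} f g = z≤n
count≤count-∧-not+count {suc n} f g with f zero | g zero | count≤count-∧-not+count (f ∘ suc) (g ∘ suc)
... | true | true | le = ℕ.≤-trans (s≤s le) (ℕ.≤-reflexive (sym (ℕ.+-suc _ _)))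
... | true | false | le = s≤s le
... | false | true | le = ℕ.≤-trans le (ℕ.+-monoʳ-≤ _ (ℕ.n≤1+n _))
... | false | false | le = le

count-not≤count+1 : ∀ {n} (B X bad : Fin n → Bool) → AtMostOne bad →
  (∀ i → B i ≡ false → bad i ≡ false → X i ≡ true) → count (not ∘ B) ≤ count X + 1
count-not≤count+1 B X bad bad≤1 covered = begin
  count (not ∘ B)                                     ≤⟨ count≤count-∧-not+count (not ∘ B) bad ⟩
  count (λ i → not (B i) ∧ not (bad i)) + count bad   ≤⟨ ℕ.+-mono-≤ (count-mono hit) (count≤1 bad bad≤1) ⟩
  count X + 1                                         ∎
  where
  open ℕ.≤-Reasoning
  hit : (λ i → not (B i) ∧ not (bad i)) ⊆ᵇ X
  hit i p = let (¬B , ¬bad) = ∧-true⁻ (not (B i)) p in covered i (not-true⇒false ¬B) (not-true⇒false ¬bad)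

count-eqᵇ : ∀ {n} (i : Fin n) → count (eqᵇ i) ≡ 1
count-eqᵇ i = ℕ.≤-antisym (count≤1 (eqᵇ i) λ j j′ p p′ → trans (sym (eqᵇ⇒≡ p)) (eqᵇ⇒≡ p′))
  (subst (λ b → ind b ≤ count (eqᵇ i)) (eqᵇ-refl i) (count-term (eqᵇ i) i))

count-<ᵇ : ∀ {n} m → m ≤ n → count {n} (λ i → toℕ i <ᵇ m) ≡ m
count-<ᵇ {zero} zero _ = refl
count-<ᵇ {suc n} zero _ = count-zero {suc n} _ (λ _ → refl)
count-<ᵇ {suc n} (suc m) (s≤s m≤n) = cong suc (count-<ᵇ m m≤n)

any-allFin⁺ : ∀ {n} (p : Fin n → Bool) i → p i ≡ true → any p (allFin n) ≡ true
any-allFin⁺ p i pi = T⇒≡ (any⁺ p (lose (∈-allFin i) (≡⇒T pi)))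

any-allFin⁻ : ∀ {n} (p : Fin n → Bool) → any p (allFin n) ≡ true → ∃ λ i → p i ≡ true
any-allFin⁻ {n} p any≡true with satisfied (any⁻ p (allFin n) (≡⇒T any≡true))
... | i , pi = i , T⇒≡ pi

ind-any≤count : ∀ {n} (p : Fin n → Bool) → ind (any p (allFin n)) ≤ count p
ind-any≤count {n} p with any p (allFin n) in any≡
... | false = z≤n
... | true with any-allFin⁻ p any≡
...   | i , pi = subst (λ b → ind b ≤ count p) pi (count-term p i)

-- Power propagation in an arbitrary graph

module Propagation (G : Graph) where

  private
    V : Set
    V = Fin (order G)

  Nᵇ : V → V → Bool
  Nᵇ u = lookup (N[ G ] u)

  lookup-N[] : ∀ v w → Nᵇ v w ≡ eqᵇ w v ∨ adj G v w
  lookup-N[] v = lookup∘tabulate (λ w → eqᵇ w v ∨ adj G v w)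

  ∣N[_]∖_∣ : V → (V → Bool) → ℕ
  ∣N[ u ]∖ A ∣ = count (λ z → Nᵇ u z ∧ not (A z))

  ∣N[]∩∁∣≡ : ∀ u (P : Subset (order G)) → ∣ N[ G ] u ∩ ∁ P ∣ ≡ ∣N[ u ]∖ lookup P ∣
  ∣N[]∩∁∣≡ u P = trans (∣p∣≡count (N[ G ] u ∩ ∁ P)) (count-cong λ z →
    trans (lookup-zipWith _∧_ z (N[ G ] u) (∁ P)) (cong (Nᵇ u z ∧_) (lookup-map z not P)))

  ∈N[]ˢ⁺ : ∀ S v w → lookup S v ≡ true → Nᵇ v w ≡ true → lookup (N[ G ]ˢ S) w ≡ true
  ∈N[]ˢ⁺ S v w v∈S w∈Nv = trans (lookup∘tabulate _ w) (any-allFin⁺ _ v (cong₂ _∧_ v∈S w∈Nv))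

  ∈N[]ˢ⁻ : ∀ S w → lookup (N[ G ]ˢ S) w ≡ true → ∃ λ v → lookup S v ≡ true × Nᵇ v w ≡ true
  ∈N[]ˢ⁻ S w w∈NS with any-allFin⁻ _ (trans (sym (lookup∘tabulate _ w)) w∈NS)
  ... | v , p = v , ∧-true⁻ (lookup S v) p

  ∈step⁺ : ∀ {k} P u w → lookup P u ≡ true → ∣N[ u ]∖ lookup P ∣ ≤ k → Nᵇ u w ≡ true → lookup (step G k P) w ≡ true
  ∈step⁺ {k} P u w u∈P few w∈Nu = trans (lookup∘tabulate _ w) (any-allFin⁺ _ u
    (cong₂ _∧_ u∈P (cong₂ _∧_ (T⇒≡ (ℕ.≤⇒≤ᵇ (subst (_≤ k) (sym (∣N[]∩∁∣≡ u P)) few))) w∈Nu)))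

  ∈step⁻ : ∀ {k} P w → lookup (step G k P) w ≡ true →
    ∃ λ u → lookup P u ≡ true × ∣N[ u ]∖ lookup P ∣ ≤ k × Nᵇ u w ≡ true
  ∈step⁻ {k} P w w∈step with any-allFin⁻ _ (trans (sym (lookup∘tabulate _ w)) w∈step)
  ... | u , p with ∧-true⁻ (lookup P u) p
  ... | u∈P , q with ∧-true⁻ (∣ N[ G ] u ∩ ∁ P ∣ ≤ᵇ k) q
  ... | few , w∈Nu = u , u∈P , subst (_≤ k) (∣N[]∩∁∣≡ u P) (ℕ.≤ᵇ⇒≤ _ k (≡⇒T few)) , w∈Nu

  forces : ∀ {k} P (A : V → Bool) → A ⊆ᵇ lookup P → ∀ u w → A u ≡ true → ∣N[ u ]∖ A ∣ ≤ k →
    Nᵇ u w ≡ true → lookup (step G k P) w ≡ true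
  forces P A A⊆P u w u∈A few w∈Nu = ∈step⁺ P u w (A⊆P u u∈A)
    (ℕ.≤-trans (count-mono λ z p → let (z∈Nu , z∉P) = ∧-true⁻ (Nᵇ u z) p in
                                    cong₂ _∧_ z∈Nu (not-antitone (A⊆P z) z∉P)) few) w∈Nu

  N[]-refl : ∀ v → Nᵇ v v ≡ true
  N[]-refl v = trans (lookup-N[] v v) (cong (_∨ adj G v v) (eqᵇ-refl v))

  ∣N[]∖∣≡0 : ∀ u (A : V → Bool) → Nᵇ u ⊆ᵇ A → ∣N[ u ]∖ A ∣ ≡ 0
  ∣N[]∖∣≡0 u A N⊆A = count-zero _ λ z → unobserved-false z (Nᵇ u z) refl
    where
    unobserved-false : ∀ z b → Nᵇ u z ≡ b → b ∧ not (A z) ≡ false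
    unobserved-false z false _ = refl
    unobserved-false z true z∈Nu rewrite N⊆A z z∈Nu = refl

  𝒫-mono : ∀ k S t → lookup (𝒫 G k t S) ⊆ᵇ lookup (𝒫 G k (suc t) S)
  𝒫-mono k S zero w w∈𝒫 with ∈N[]ˢ⁻ S w w∈𝒫
  ... | v , v∈S , w∈Nv = ∈step⁺ (N[ G ]ˢ S) v w (∈N[]ˢ⁺ S v v v∈S (N[]-refl v))
    (ℕ.≤-trans (ℕ.≤-reflexive (∣N[]∖∣≡0 v _ λ z z∈Nv → ∈N[]ˢ⁺ S v z v∈S z∈Nv)) z≤n) w∈Nv
  𝒫-mono k S (suc t) w w∈𝒫 with ∈step⁻ (𝒫 G k t S) w w∈𝒫
  ... | u , u∈P , few , w∈Nu = forces (𝒫 G k (suc t) S) (lookup (𝒫 G k t S)) (𝒫-mono k S t) u w u∈P few w∈Nu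

  all-observed : ∀ {k S} → IsKPowerDominating G k S → ∃ λ t → ∀ w → lookup (𝒫 G k t S) w ≡ true
  all-observed (t , 𝒫≡⊤) = t , λ w → trans (cong (λ P → lookup P w) 𝒫≡⊤) (lookup-⊤ w)

  𝒫⊆invariant : ∀ k S (U : V → Bool) →
    (∀ v w → lookup S v ≡ true → Nᵇ v w ≡ true → U w ≡ true) →
    (∀ P u w → lookup P ⊆ᵇ U → lookup P u ≡ true → ∣N[ u ]∖ lookup P ∣ ≤ k → Nᵇ u w ≡ true → U w ≡ true) →
    ∀ t → lookup (𝒫 G k t S) ⊆ᵇ U
  𝒫⊆invariant k S U base closed zero w w∈𝒫 with ∈N[]ˢ⁻ S w w∈𝒫
  ... | v , v∈S , w∈Nv = base v w v∈S w∈Nv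
  𝒫⊆invariant k S U base closed (suc t) w w∈𝒫 with ∈step⁻ (𝒫 G k t S) w w∈𝒫
  ... | u , u∈P , few , w∈Nu = closed (𝒫 G k t S) u w (𝒫⊆invariant k S U base closed t) u∈P few w∈Nu

-- Isomorphisms and automorphisms

module Isomorphism (G H : Graph) (σ : Permutation (order G) (order H))
    (σ-adj : ∀ x y → adj H (σ ⟨$⟩ʳ x) (σ ⟨$⟩ʳ y) ≡ adj G x y) where

  private
    module PG = Propagation G
    module PH = Propagation H

  image : Subset (order G) → Subset (order H)
  image P = tabulate (lookup P ∘ (σ ⟨$⟩ˡ_))

  lookup-image : ∀ P x → lookup (image P) (σ ⟨$⟩ʳ x) ≡ lookup P x
  lookup-image P x = trans (lookup∘tabulate (lookup P ∘ (σ ⟨$⟩ˡ_)) (σ ⟨$⟩ʳ x)) (cong (lookup P) (inverseˡ σ))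

  ∣image∣ : ∀ P → ∣ image P ∣ ≡ ∣ P ∣
  ∣image∣ P = begin
    ∣ image P ∣                          ≡⟨ ∣tabulate∣≡count (lookup P ∘ (σ ⟨$⟩ˡ_)) ⟩
    count (lookup P ∘ (σ ⟨$⟩ˡ_))          ≡⟨ count-permute (flip σ) (lookup P) ⟩
    count (lookup P)                     ≡⟨ ∣p∣≡count P ⟨
    ∣ P ∣                                ∎
    where open ≡-Reasoning

  N[]-image : ∀ v w → PH.Nᵇ (σ ⟨$⟩ʳ v) (σ ⟨$⟩ʳ w) ≡ PG.Nᵇ v w
  N[]-image v w = begin
    PH.Nᵇ (σ ⟨$⟩ʳ v) (σ ⟨$⟩ʳ w)                                     ≡⟨ PH.lookup-N[] _ _ ⟩
    eqᵇ (σ ⟨$⟩ʳ w) (σ ⟨$⟩ʳ v) ∨ adj H (σ ⟨$⟩ʳ v) (σ ⟨$⟩ʳ w)         ≡⟨ cong₂ _∨_ (eqᵇ-injective _ (⟨$⟩ʳ-injective σ) w v) (σ-adj v w) ⟩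
    eqᵇ w v ∨ adj G v w                                            ≡⟨ PG.lookup-N[] v w ⟨
    PG.Nᵇ v w                                                      ∎
    where open ≡-Reasoning

  lookup-image-σ⁻¹ : ∀ P z → lookup (image P) z ≡ lookup P (σ ⟨$⟩ˡ z)
  lookup-image-σ⁻¹ P = lookup∘tabulate (lookup P ∘ (σ ⟨$⟩ˡ_))

  ∣N[]∖image∣ : ∀ u P → PH.∣N[ σ ⟨$⟩ʳ u ]∖ lookup (image P) ∣ ≡ PG.∣N[ u ]∖ lookup P ∣
  ∣N[]∖image∣ u P = trans (sym (count-permute σ (λ z → PH.Nᵇ (σ ⟨$⟩ʳ u) z ∧ not (lookup (image P) z)))) (count-cong λ x →
    cong₂ (λ a b → a ∧ not b) (N[]-image u x) (lookup-image P x))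

  𝒫-image : ∀ k S t w → lookup (𝒫 G k t S) w ≡ true → lookup (𝒫 H k t (image S)) (σ ⟨$⟩ʳ w) ≡ true
  𝒫-image k S zero w w∈𝒫 with PG.∈N[]ˢ⁻ S w w∈𝒫
  ... | v , v∈S , w∈Nv =
    PH.∈N[]ˢ⁺ (image S) (σ ⟨$⟩ʳ v) (σ ⟨$⟩ʳ w) (trans (lookup-image S v) v∈S) (trans (N[]-image v w) w∈Nv)
  𝒫-image k S (suc t) w w∈𝒫 with PG.∈step⁻ (𝒫 G k t S) w w∈𝒫
  ... | u , u∈P , few , w∈Nu =
    PH.forces (𝒫 H k t (image S)) (lookup (image (𝒫 G k t S))) image⊆ (σ ⟨$⟩ʳ u) (σ ⟨$⟩ʳ w)
      (trans (lookup-image (𝒫 G k t S) u) u∈P) (subst (_≤ k) (sym (∣N[]∖image∣ u (𝒫 G k t S))) few)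
      (trans (N[]-image u w) w∈Nu)
    where
    image⊆ : lookup (image (𝒫 G k t S)) ⊆ᵇ lookup (𝒫 H k t (image S))
    image⊆ z z∈image = subst (λ z → lookup (𝒫 H k t (image S)) z ≡ true) (inverseʳ σ)
      (𝒫-image k S t (σ ⟨$⟩ˡ z) (trans (sym (lookup-image-σ⁻¹ (𝒫 G k t S) z)) z∈image))

  image-dominating : ∀ k S → IsKPowerDominating G k S → IsKPowerDominating H k (image S)
  image-dominating k S dominating with PG.all-observed dominating
  ... | t , observed = t , all-inside⇒≡⊤ _ λ z →
    subst (λ z → lookup (𝒫 H k t (image S)) z ≡ true) (inverseʳ σ) (𝒫-image k S t (σ ⟨$⟩ˡ z) (observed _))

γ-invariant : ∀ (G H : Graph) (σ : Permutation (order G) (order H)) →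
  (∀ x y → adj H (σ ⟨$⟩ʳ x) (σ ⟨$⟩ʳ y) ≡ adj G x y) →
  ∀ k m → PowerDominationNumberIs G k m → PowerDominationNumberIs H k m
γ-invariant G H σ σ-adj k m ((S , S-dom , ∣S∣≡m) , minimal) =
  (image S , image-dominating k S S-dom , trans (∣image∣ S) ∣S∣≡m) ,
  λ S′ S′-dom → subst (m ≤_) (Inverse.∣image∣ S′) (minimal _ (Inverse.image-dominating k S′ S′-dom))
  where
  open Isomorphism G H σ σ-adj
  σ⁻¹-adj : ∀ x y → adj G (σ ⟨$⟩ˡ x) (σ ⟨$⟩ˡ y) ≡ adj H x y
  σ⁻¹-adj x y = trans (sym (σ-adj _ _)) (cong₂ (adj H) (inverseʳ σ) (inverseʳ σ))
  module Inverse = Isomorphism H G (flip σ) σ⁻¹-adj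

IsAutomorphism : (G : Graph) → Permutation (order G) (order G) → Set
IsAutomorphism G σ = ∀ x y → adj G (σ ⟨$⟩ʳ x) (σ ⟨$⟩ʳ y) ≡ adj G x y

∘ₚ-automorphism : ∀ G σ τ → IsAutomorphism G σ → IsAutomorphism G τ → IsAutomorphism G (σ ∘ₚ τ)
∘ₚ-automorphism G σ τ σ-aut τ-aut x y = trans (τ-aut _ _) (σ-aut x y)

─-automorphism : ∀ G σ → IsAutomorphism G σ → ∀ (e₀ e : Edge G) →
  σ ⟨$⟩ʳ proj₁ e₀ ≡ proj₁ e → σ ⟨$⟩ʳ proj₁ (proj₂ e₀) ≡ proj₁ (proj₂ e) →
  ∀ x y → adj (G ─ e) (σ ⟨$⟩ʳ x) (σ ⟨$⟩ʳ y) ≡ adj (G ─ e₀) x y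
─-automorphism G σ σ-aut (u₀ , v₀ , _) (_ , _ , _) refl refl x y =
  cong₂ (λ A B → A ∧ not B) (σ-aut x y)
    (cong₂ _∨_ (cong₂ _∧_ (σ-eqᵇ x u₀) (σ-eqᵇ y v₀)) (cong₂ _∧_ (σ-eqᵇ x v₀) (σ-eqᵇ y u₀)))
  where
  σ-eqᵇ : ∀ x y → eqᵇ (σ ⟨$⟩ʳ x) (σ ⟨$⟩ʳ y) ≡ eqᵇ x y
  σ-eqᵇ = eqᵇ-injective (σ ⟨$⟩ʳ_) (⟨$⟩ʳ-injective σ)

transpose-matchˡ : ∀ {n} (i j : Fin n) → transpose i j ⟨$⟩ʳ i ≡ j
transpose-matchˡ i j with i ≟ i
... | yes _ = refl
... | no i≢i = contradiction refl i≢i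

transpose-fix : ∀ {n} (i j k : Fin n) → k ≢ i → k ≢ j → transpose i j ⟨$⟩ʳ k ≡ k
transpose-fix i j k k≢i k≢j with k ≟ i
... | yes k≡i = contradiction k≡i k≢i
... | no _ with k ≟ j
...   | yes k≡j = contradiction k≡j k≢j
...   | no _ = refl

two-point : ∀ {n} (x y : Fin (suc (suc n))) → x ≢ y →
  Σ (Permutation _ _) λ π → π ⟨$⟩ʳ zero ≡ x × π ⟨$⟩ʳ suc zero ≡ y
two-point {n} x y x≢y = transpose (suc zero) y′ ∘ₚ transpose zero x , maps-0 , maps-1
  where
  y′ : Fin (suc (suc n))
  y′ = transpose x zero ⟨$⟩ʳ y
  y′≢0 : zero ≢ y′
  y′≢0 0≡y′ = x≢y (begin
    x                                        ≡⟨ transpose-matchˡ zero x ⟨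
    transpose zero x ⟨$⟩ʳ zero                ≡⟨ cong (transpose zero x ⟨$⟩ʳ_) 0≡y′ ⟩
    transpose zero x ⟨$⟩ʳ y′                  ≡⟨ inverseˡ (transpose x zero) ⟩
    y                                        ∎)
    where open ≡-Reasoning
  maps-0 : transpose zero x ⟨$⟩ʳ (transpose (suc zero) y′ ⟨$⟩ʳ zero) ≡ x
  maps-0 = trans (cong (transpose zero x ⟨$⟩ʳ_) (transpose-fix (suc zero) y′ zero (λ ()) y′≢0))
                 (transpose-matchˡ zero x)
  maps-1 : transpose zero x ⟨$⟩ʳ (transpose (suc zero) y′ ⟨$⟩ʳ suc zero) ≡ y
  maps-1 = trans (cong (transpose zero x ⟨$⟩ʳ_) (transpose-matchˡ (suc zero) y′))
                 (inverseˡ (transpose x zero))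

-- The rook's graph K_a □ K_a

module Rook (a : ℕ) where

  Rook : Graph
  Rook = K a □ K a

  V : Set
  V = Fin (a * a)

  row col : V → Fin a
  row z = proj₁ (remQuot {a} a z)
  col z = proj₂ (remQuot {a} a z)

  ⟨_,_⟩ : Fin a → Fin a → V
  ⟨ g , h ⟩ = combine g h

  row-⟨⟩ : ∀ g h → row ⟨ g , h ⟩ ≡ g
  row-⟨⟩ g h = cong proj₁ (Fin.remQuot-combine g h)

  col-⟨⟩ : ∀ g h → col ⟨ g , h ⟩ ≡ h
  col-⟨⟩ g h = cong proj₂ (Fin.remQuot-combine g h)

  ⟨row,col⟩ : ∀ z → ⟨ row z , col z ⟩ ≡ z
  ⟨row,col⟩ = Fin.combine-remQuot {a} a

  coords-injective : ∀ {x y} → row x ≡ row y → col x ≡ col y → x ≡ y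
  coords-injective {x} {y} r c = trans (sym (⟨row,col⟩ x)) (trans (cong₂ ⟨_,_⟩ r c) (⟨row,col⟩ y))

  lineAdj : Bool → Bool → Bool
  lineAdj sameRow sameCol = (sameRow ∧ not sameCol) ∨ (sameCol ∧ not sameRow)

  adj-Rook : ∀ x y → adj Rook x y ≡ lineAdj (eqᵇ (row x) (row y)) (eqᵇ (col x) (col y))
  adj-Rook x y with remQuot {a} a x | remQuot {a} a y
  ... | _ | _ = refl

  adj-⟨⟩ : ∀ g h g′ h′ → adj Rook ⟨ g , h ⟩ ⟨ g′ , h′ ⟩ ≡ lineAdj (eqᵇ g g′) (eqᵇ h h′)
  adj-⟨⟩ g h g′ h′ = trans (adj-Rook _ _)
    (cong₂ lineAdj (cong₂ eqᵇ (row-⟨⟩ g h) (row-⟨⟩ g′ h′)) (cong₂ eqᵇ (col-⟨⟩ g h) (col-⟨⟩ g′ h′)))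

  _⊗_ : Permutation a a → Permutation a a → Permutation (a * a) (a * a)
  α ⊗ β = permutation (λ z → ⟨ α ⟨$⟩ʳ row z , β ⟨$⟩ʳ col z ⟩) (λ z → ⟨ α ⟨$⟩ˡ row z , β ⟨$⟩ˡ col z ⟩)
    (λ z → trans (cong₂ (λ g h → ⟨ α ⟨$⟩ʳ g , β ⟨$⟩ʳ h ⟩) (row-⟨⟩ _ _) (col-⟨⟩ _ _))
                 (trans (cong₂ ⟨_,_⟩ (inverseʳ α) (inverseʳ β)) (⟨row,col⟩ z)))
    (λ z → trans (cong₂ (λ g h → ⟨ α ⟨$⟩ˡ g , β ⟨$⟩ˡ h ⟩) (row-⟨⟩ _ _) (col-⟨⟩ _ _))
                 (trans (cong₂ ⟨_,_⟩ (inverseˡ α) (inverseˡ β)) (⟨row,col⟩ z)))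

  transposeᴿ : Permutation (a * a) (a * a)
  transposeᴿ = permutation swap swap swap-involutive swap-involutive
    where
    swap : V → V
    swap z = ⟨ col z , row z ⟩
    swap-involutive : ∀ z → swap (swap z) ≡ z
    swap-involutive z = trans (cong₂ ⟨_,_⟩ (col-⟨⟩ _ _) (row-⟨⟩ _ _)) (⟨row,col⟩ z)

  ⊗-automorphism : ∀ α β → IsAutomorphism Rook (α ⊗ β)
  ⊗-automorphism α β x y = begin
    adj Rook ⟨ α ⟨$⟩ʳ row x , β ⟨$⟩ʳ col x ⟩ ⟨ α ⟨$⟩ʳ row y , β ⟨$⟩ʳ col y ⟩
      ≡⟨ adj-⟨⟩ _ _ _ _ ⟩
    lineAdj (eqᵇ (α ⟨$⟩ʳ row x) (α ⟨$⟩ʳ row y)) (eqᵇ (β ⟨$⟩ʳ col x) (β ⟨$⟩ʳ col y))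
      ≡⟨ cong₂ lineAdj (eqᵇ-injective (α ⟨$⟩ʳ_) (⟨$⟩ʳ-injective α) _ _)
                       (eqᵇ-injective (β ⟨$⟩ʳ_) (⟨$⟩ʳ-injective β) _ _) ⟩
    lineAdj (eqᵇ (row x) (row y)) (eqᵇ (col x) (col y))
      ≡⟨ adj-Rook x y ⟨
    adj Rook x y ∎
    where open ≡-Reasoning

  transposeᴿ-automorphism : IsAutomorphism Rook transposeᴿ
  transposeᴿ-automorphism x y = begin
    adj Rook ⟨ col x , row x ⟩ ⟨ col y , row y ⟩          ≡⟨ adj-⟨⟩ _ _ _ _ ⟩
    lineAdj (eqᵇ (col x) (col y)) (eqᵇ (row x) (row y))  ≡⟨ ∨-comm (eqᵇ (col x) (col y) ∧ not (eqᵇ (row x) (row y))) _ ⟩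
    lineAdj (eqᵇ (row x) (row y)) (eqᵇ (col x) (col y))  ≡⟨ adj-Rook x y ⟨
    adj Rook x y                                         ∎
    where open ≡-Reasoning

  adj-Rook⁻ : ∀ x y → adj Rook x y ≡ true →
    (row x ≡ row y × col x ≢ col y) ⊎ (col x ≡ col y × row x ≢ row y)
  adj-Rook⁻ x y xy = lineAdj⁻ (trans (sym (adj-Rook x y)) xy)
    where
    lineAdj⁻ : ∀ {g g′ h h′ : Fin a} → lineAdj (eqᵇ g g′) (eqᵇ h h′) ≡ true →
      (g ≡ g′ × h ≢ h′) ⊎ (h ≡ h′ × g ≢ g′)
    lineAdj⁻ {g} {g′} {h} {h′} p with g ≟ g′ | h ≟ h′
    ... | yes g≡g′ | no h≢h′ = inj₁ (g≡g′ , h≢h′)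
    ... | no g≢g′ | yes h≡h′ = inj₂ (h≡h′ , g≢g′)

  adj-Rook⁺ : ∀ x y → x ≢ y → row x ≡ row y ⊎ col x ≡ col y → adj Rook x y ≡ true
  adj-Rook⁺ x y x≢y line rewrite adj-Rook x y with row x ≟ row y | col x ≟ col y
  ... | yes r | yes c = contradiction (coords-injective r c) x≢y
  ... | yes _ | no _ = refl
  ... | no _ | yes _ = refl
  ... | no r | no c = contradiction line [ r , c ]′

  ⟨⟩≡ : ∀ {g h} z → g ≡ row z → h ≡ col z → ⟨ g , h ⟩ ≡ z
  ⟨⟩≡ z refl refl = ⟨row,col⟩ z

  count-row≤ : ∀ (F : V → Bool) g → count (λ h → F ⟨ g , h ⟩) ≤ count F
  count-row≤ F g = subst (count (λ h → F ⟨ g , h ⟩) ≤_) (sym (count-combine {a} {a} F))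
    (sum-term (λ g → count (λ h → F ⟨ g , h ⟩)) g)

  count-in-row : ∀ (F : V → Bool) i (E : Fin a → Bool) →
    (∀ z → F z ≡ true → row z ≡ i × E (col z) ≡ true) → count F ≤ count E
  count-in-row F i E F⊆ = begin
    count F                                     ≡⟨ count-combine {a} {a} F ⟩
    ∑[ g < a ] count (λ h → F ⟨ g , h ⟩)         ≤⟨ sum≤single _ i (λ g g≢i → count-zero _ (other-row g g≢i)) ⟩
    count (λ h → F ⟨ i , h ⟩)                    ≤⟨ count-mono (λ h p → subst (λ h → E h ≡ true) (col-⟨⟩ i h) (proj₂ (F⊆ _ p))) ⟩
    count E                                     ∎
    where
    open ℕ.≤-Reasoning
    other-row : ∀ g → g ≢ i → ∀ h → F ⟨ g , h ⟩ ≡ false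
    other-row g g≢i h = ¬-not (λ p → g≢i (trans (sym (row-⟨⟩ g h)) (proj₁ (F⊆ _ p))))

  count-occupied-rows : ∀ (F : V → Bool) → count (λ g → any (λ h → F ⟨ g , h ⟩) (allFin a)) ≤ count F
  count-occupied-rows F = ℕ.≤-trans (sum-mono λ g → ind-any≤count (λ h → F ⟨ g , h ⟩)) (ℕ.≤-reflexive (sym (count-combine {a} {a} F)))

  swap : V → V
  swap z = transposeᴿ ⟨$⟩ʳ z

  swap-⟨⟩ : ∀ g h → swap ⟨ g , h ⟩ ≡ ⟨ h , g ⟩
  swap-⟨⟩ g h = cong₂ ⟨_,_⟩ (col-⟨⟩ g h) (row-⟨⟩ g h)

  count-col≤ : ∀ (F : V → Bool) h → count (λ g → F ⟨ g , h ⟩) ≤ count F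
  count-col≤ F h = begin
    count (λ g → F ⟨ g , h ⟩)          ≡⟨ count-cong (λ g → cong F (swap-⟨⟩ h g)) ⟨
    count (λ g → F (swap ⟨ h , g ⟩))   ≤⟨ count-row≤ (F ∘ swap) h ⟩
    count (F ∘ swap)                   ≡⟨ count-permute transposeᴿ F ⟩
    count F                            ∎
    where open ℕ.≤-Reasoning

  count-in-col : ∀ (F : V → Bool) j (E : Fin a → Bool) →
    (∀ z → F z ≡ true → col z ≡ j × E (row z) ≡ true) → count F ≤ count E
  count-in-col F j E F⊆ = begin
    count F          ≡⟨ count-permute transposeᴿ F ⟨
    count (F ∘ swap) ≤⟨ count-in-row (F ∘ swap) j E (λ z p → let (c , e) = F⊆ _ p in
                          trans (sym (col-⟨⟩ (col z) (row z))) c , subst (λ g → E g ≡ true) (row-⟨⟩ (col z) (row z)) e) ⟩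
    count E          ∎
    where open ℕ.≤-Reasoning

  count-occupied-cols : ∀ (F : V → Bool) → count (λ h → any (λ g → F ⟨ g , h ⟩) (allFin a)) ≤ count F
  count-occupied-cols F = begin
    count (λ h → any (λ g → F ⟨ g , h ⟩) (allFin a))         ≡⟨ count-cong (λ h → cong or (map-cong (λ g → cong F (swap-⟨⟩ h g)) (allFin a))) ⟨
    count (λ h → any (λ g → F (swap ⟨ h , g ⟩)) (allFin a))  ≤⟨ count-occupied-rows (F ∘ swap) ⟩
    count (F ∘ swap)                                       ≡⟨ count-permute transposeᴿ F ⟩
    count F                                                ∎
    where open ℕ.≤-Reasoning

module RookEdge (b : ℕ) where

  open Rook (suc (suc b))

  e₀ : Edge Rook
  e₀ = ⟨ zero , zero ⟩ , ⟨ zero , suc zero ⟩ , refl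

  edge-transitive : (e : Edge Rook) → Σ (Permutation _ _) λ σ → IsAutomorphism Rook σ ×
    σ ⟨$⟩ʳ proj₁ e₀ ≡ proj₁ e × σ ⟨$⟩ʳ proj₁ (proj₂ e₀) ≡ proj₁ (proj₂ e)
  edge-transitive (u , v , uv) with adj-Rook⁻ u v uv
  ... | inj₁ (same-row , col≢) with two-point (col u) (col v) col≢
  ...   | β , β0 , β1 = transpose zero (row u) ⊗ β , ⊗-automorphism (transpose zero (row u)) β ,
    ⟨⟩≡ u (transpose-matchˡ zero (row u)) β0 ,
    ⟨⟩≡ v (trans (transpose-matchˡ zero (row u)) same-row) β1
  edge-transitive (u , v , uv) | inj₂ (same-col , row≢) with two-point (row u) (row v) row≢
  ...   | α , α0 , α1 = (transpose zero (col u) ⊗ α) ∘ₚ transposeᴿ ,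
    ∘ₚ-automorphism Rook (transpose zero (col u) ⊗ α) transposeᴿ (⊗-automorphism (transpose zero (col u)) α) transposeᴿ-automorphism ,
    ⟨⟩≡ u (trans (col-⟨⟩ τ0 (α ⟨$⟩ʳ zero)) α0) (trans (row-⟨⟩ τ0 (α ⟨$⟩ʳ zero)) τ0≡) ,
    ⟨⟩≡ v (trans (col-⟨⟩ τ0 (α ⟨$⟩ʳ suc zero)) α1) (trans (row-⟨⟩ τ0 (α ⟨$⟩ʳ suc zero)) (trans τ0≡ same-col))
    where
    τ0 : Fin (suc (suc b))
    τ0 = transpose zero (col u) ⟨$⟩ʳ zero
    τ0≡ : τ0 ≡ col u
    τ0≡ = transpose-matchˡ zero (col u)

  γ-edge-invariant : ∀ k m (e : Edge Rook) →
    PowerDominationNumberIs (Rook ─ e₀) k m → PowerDominationNumberIs (Rook ─ e) k m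
  γ-edge-invariant k m e γ₀ with edge-transitive e
  ... | σ , σ-aut , σu , σv = γ-invariant (Rook ─ e₀) (Rook ─ e) σ (─-automorphism Rook σ σ-aut e₀ e σu σv) k m γ₀

-- The rook's graph without the edge ⟨0,0⟩⟨0,1⟩

module DeletedEdge (b : ℕ) where

  a : ℕ
  a = suc (suc (suc b))

  open Rook a
  open RookEdge (suc b) using (e₀)

  G₀ : Graph
  G₀ = Rook ─ e₀

  open Propagation G₀

  u₀ v₀ : V
  u₀ = ⟨ zero , zero ⟩
  v₀ = ⟨ zero , suc zero ⟩

  u₀≢v₀ : u₀ ≢ v₀
  u₀≢v₀ u₀≡v₀ with cong col u₀≡v₀
  ... | ()

  Deleted : V → V → Set
  Deleted x y = (x ≡ u₀ × y ≡ v₀) ⊎ (x ≡ v₀ × y ≡ u₀)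

  deleted? : ∀ x y → Dec (Deleted x y)
  deleted? x y = (x ≟ u₀ ×-dec y ≟ v₀) ⊎-dec (x ≟ v₀ ×-dec y ≟ u₀)

  Deleted-unique : ∀ {x y y′} → Deleted x y → Deleted x y′ → y ≡ y′
  Deleted-unique (inj₁ (_ , y≡v₀)) (inj₁ (_ , y′≡v₀)) = trans y≡v₀ (sym y′≡v₀)
  Deleted-unique (inj₂ (_ , y≡u₀)) (inj₂ (_ , y′≡u₀)) = trans y≡u₀ (sym y′≡u₀)
  Deleted-unique (inj₁ (x≡u₀ , _)) (inj₂ (x≡v₀ , _)) = contradiction (trans (sym x≡u₀) x≡v₀) u₀≢v₀
  Deleted-unique (inj₂ (x≡v₀ , _)) (inj₁ (x≡u₀ , _)) = contradiction (trans (sym x≡u₀) x≡v₀) u₀≢v₀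

  Deleted⇒row≡0 : ∀ {x y} → Deleted x y → row x ≡ zero
  Deleted⇒row≡0 (inj₁ (refl , _)) = refl
  Deleted⇒row≡0 (inj₂ (refl , _)) = refl

  Deleted⇒col≤1 : ∀ {x y} → Deleted x y → col x ≡ zero ⊎ col x ≡ suc zero
  Deleted⇒col≤1 (inj₁ (refl , _)) = inj₁ refl
  Deleted⇒col≤1 (inj₂ (refl , _)) = inj₂ refl

  v₀-u₀-non-adjacent : Nᵇ v₀ u₀ ≡ false
  v₀-u₀-non-adjacent = refl

  N₀⁻ : ∀ x y → Nᵇ x y ≡ true → row x ≡ row y ⊎ col x ≡ col y
  N₀⁻ x y y∈Nx with ∨-true⁻ (eqᵇ y x) (trans (sym (lookup-N[] x y)) y∈Nx)
  ... | inj₁ y≡x = inj₁ (cong row (sym (eqᵇ⇒≡ y≡x)))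
  ... | inj₂ p with adj-Rook⁻ x y (proj₁ (∧-true⁻ (adj Rook x y) p))
  ...   | inj₁ (same-row , _) = inj₁ same-row
  ...   | inj₂ (same-col , _) = inj₂ same-col

  N₀⁺ : ∀ x y → row x ≡ row y ⊎ col x ≡ col y → ¬ Deleted x y → Nᵇ x y ≡ true
  N₀⁺ x y line ¬deleted with x ≟ y
  ... | yes refl = N[]-refl x
  ... | no x≢y = begin
    Nᵇ x y                          ≡⟨ lookup-N[] x y ⟩
    eqᵇ y x ∨ adj G₀ x y            ≡⟨ cong (eqᵇ y x ∨_) (cong₂ (λ A B → A ∧ not B)
                                         (adj-Rook⁺ x y x≢y line) (¬-not (¬deleted ∘ removed⇒Deleted))) ⟩
    eqᵇ y x ∨ true                  ≡⟨ ∨-zeroʳ (eqᵇ y x) ⟩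
    true                            ∎
    where
    removed⇒Deleted : (eqᵇ x u₀ ∧ eqᵇ y v₀) ∨ (eqᵇ x v₀ ∧ eqᵇ y u₀) ≡ true → Deleted x y
    removed⇒Deleted r with ∨-true⁻ (eqᵇ x u₀ ∧ eqᵇ y v₀) r
    ... | inj₁ p = let (x≡u₀ , y≡v₀) = ∧-true⁻ (eqᵇ x u₀) p in inj₁ (eqᵇ⇒≡ x≡u₀ , eqᵇ⇒≡ y≡v₀)
    ... | inj₂ p = let (x≡v₀ , y≡u₀) = ∧-true⁻ (eqᵇ x v₀) p in inj₂ (eqᵇ⇒≡ x≡v₀ , eqᵇ⇒≡ y≡u₀)
    open ≡-Reasoning

  non-neighbour-deleted : ∀ x y → row x ≡ row y ⊎ col x ≡ col y → Nᵇ x y ≡ false → Deleted x y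
  non-neighbour-deleted x y line y∉Nx with deleted? x y
  ... | yes deleted = deleted
  ... | no ¬deleted with () ← trans (sym y∉Nx) (N₀⁺ x y line ¬deleted)

  line-non-neighbours≤1 : ∀ u (ℓ : Fin a → V) → (∀ h → row u ≡ row (ℓ h) ⊎ col u ≡ col (ℓ h)) →
    (∀ {h h′} → ℓ h ≡ ℓ h′ → h ≡ h′) → AtMostOne (λ h → not (Nᵇ u (ℓ h)))
  line-non-neighbours≤1 u ℓ on-line ℓ-injective h h′ p p′ = ℓ-injective (Deleted-unique
    (non-neighbour-deleted u (ℓ h) (on-line h) (not-true⇒false p))
    (non-neighbour-deleted u (ℓ h′) (on-line h′) (not-true⇒false p′)))

  module LowerBound (k : ℕ) (S : Subset (a * a)) (small : (k + 1) + ∣ S ∣ < a) where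

    R C : Fin a → Bool
    R g = any (λ h → lookup S ⟨ g , h ⟩) (allFin a)
    C h = any (λ g → lookup S ⟨ g , h ⟩) (allFin a)

    U : V → Bool
    U z = R (row z) ∨ C (col z)

    U-⟨⟩ : ∀ g h → U ⟨ g , h ⟩ ≡ R g ∨ C h
    U-⟨⟩ g h = cong₂ (λ g h → R g ∨ C h) (row-⟨⟩ g h) (col-⟨⟩ g h)

    S<a : ∣ S ∣ < a
    S<a = ℕ.≤-<-trans (ℕ.m≤n+m ∣ S ∣ (k + 1)) small

    count-R≤ : count R ≤ ∣ S ∣
    count-R≤ = ℕ.≤-trans (count-occupied-rows (lookup S)) (ℕ.≤-reflexive (sym (∣p∣≡count S)))

    count-C≤ : count C ≤ ∣ S ∣
    count-C≤ = ℕ.≤-trans (count-occupied-cols (lookup S)) (ℕ.≤-reflexive (sym (∣p∣≡count S)))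

    -- Used on a line through u whose cross lines B mostly miss S: apart from the deleted
    -- partner of u (bad), each cell on a cross line avoiding S is an unobserved neighbour.
    sparse-line : ∀ (B X bad : Fin a → Bool) → count B ≤ ∣ S ∣ → count X ≤ k → AtMostOne bad →
      (∀ i → B i ≡ false → bad i ≡ false → X i ≡ true) → ⊥
    sparse-line B X bad count-B≤ count-X≤ bad≤1 covered = ℕ.<⇒≱ small (begin
      a                              ≡⟨ count+count-not B ⟨
      count B + count (not ∘ B)      ≤⟨ ℕ.+-mono-≤ count-B≤ (count-not≤count+1 B X bad bad≤1 covered) ⟩
      ∣ S ∣ + (count X + 1)          ≤⟨ ℕ.+-monoʳ-≤ ∣ S ∣ (ℕ.+-monoˡ-≤ 1 count-X≤) ⟩
      ∣ S ∣ + (k + 1)                ≡⟨ ℕ.+-comm ∣ S ∣ (k + 1) ⟩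
      (k + 1) + ∣ S ∣                ∎)
      where open ℕ.≤-Reasoning

    module _ (P : Subset (a * a)) (P⊆U : lookup P ⊆ᵇ U) (u : V) (few : ∣N[ u ]∖ lookup P ∣ ≤ k) where

      unobserved : V → Bool
      unobserved z = Nᵇ u z ∧ not (lookup P z)

      unobserved-if : ∀ z → U z ≡ false → Nᵇ u z ≡ true → unobserved z ≡ true
      unobserved-if z Uz≡false z∈Nu = cong₂ _∧_ z∈Nu (cong not (¬-not λ z∈P → case trans (sym (P⊆U z z∈P)) Uz≡false of λ ()))

      row-occupied : R (row u) ≡ true
      row-occupied with R (row u) in R-row
      ... | true = refl
      ... | false = ⊥-elim (sparse-line C (λ h → unobserved ⟨ row u , h ⟩) (λ h → not (Nᵇ u ⟨ row u , h ⟩))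
          count-C≤ (ℕ.≤-trans (count-row≤ unobserved (row u)) few)
          (line-non-neighbours≤1 u (λ h → ⟨ row u , h ⟩) (λ h → inj₁ (sym (row-⟨⟩ (row u) h))) col-injective)
          λ h C≡false neighbour → unobserved-if _ (trans (U-⟨⟩ (row u) h) (cong₂ _∨_ R-row C≡false)) (not-injective neighbour))
        where
        col-injective : ∀ {h h′} → ⟨ row u , h ⟩ ≡ ⟨ row u , h′ ⟩ → h ≡ h′
        col-injective {h} {h′} eq = trans (sym (col-⟨⟩ (row u) h)) (trans (cong col eq) (col-⟨⟩ (row u) h′))

      col-occupied : C (col u) ≡ true
      col-occupied with C (col u) in C-col
      ... | true = refl
      ... | false = ⊥-elim (sparse-line R (λ g → unobserved ⟨ g , col u ⟩) (λ g → not (Nᵇ u ⟨ g , col u ⟩))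
          count-R≤ (ℕ.≤-trans (count-col≤ unobserved (col u)) few)
          (line-non-neighbours≤1 u (λ g → ⟨ g , col u ⟩) (λ g → inj₂ (sym (col-⟨⟩ g (col u)))) row-injective)
          λ g R≡false neighbour → unobserved-if _ (trans (U-⟨⟩ g (col u)) (cong₂ _∨_ R≡false C-col)) (not-injective neighbour))
        where
        row-injective : ∀ {g g′} → ⟨ g , col u ⟩ ≡ ⟨ g′ , col u ⟩ → g ≡ g′
        row-injective {g} {g′} eq = trans (sym (row-⟨⟩ g (col u))) (trans (cong row eq) (row-⟨⟩ g′ (col u)))

    lines-in-U : ∀ v w → R (row v) ≡ true → C (col v) ≡ true → row v ≡ row w ⊎ col v ≡ col w → U w ≡ true
    lines-in-U v w R-row _ (inj₁ same-row) = cong (_∨ C (col w)) (trans (cong R (sym same-row)) R-row)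
    lines-in-U v w _ C-col (inj₂ same-col) =
      trans (cong (R (row w) ∨_) (trans (cong C (sym same-col)) C-col)) (∨-zeroʳ (R (row w)))

    S-occupied : ∀ v → lookup S v ≡ true → R (row v) ≡ true × C (col v) ≡ true
    S-occupied v v∈S =
      any-allFin⁺ (λ h → lookup S ⟨ row v , h ⟩) (col v) v∈S′ , any-allFin⁺ (λ g → lookup S ⟨ g , col v ⟩) (row v) v∈S′
      where
      v∈S′ : lookup S ⟨ row v , col v ⟩ ≡ true
      v∈S′ = trans (cong (lookup S) (⟨row,col⟩ v)) v∈S

    observed⊆U : ∀ t → lookup (𝒫 G₀ k t S) ⊆ᵇ U
    observed⊆U = 𝒫⊆invariant k S U
      (λ v w v∈S w∈Nv → let (R-row , C-col) = S-occupied v v∈S in lines-in-U v w R-row C-col (N₀⁻ v w w∈Nv))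
      (λ P u w P⊆U _ few w∈Nu → lines-in-U u w (row-occupied P P⊆U u few) (col-occupied P P⊆U u few) (N₀⁻ u w w∈Nu))

    vertex-outside-U : ∃ λ z → U z ≡ false
    vertex-outside-U =
      let (g , R≡false) = count<n⇒false R (ℕ.≤-<-trans count-R≤ S<a)
          (h , C≡false) = count<n⇒false C (ℕ.≤-<-trans count-C≤ S<a)
      in ⟨ g , h ⟩ , trans (U-⟨⟩ g h) (cong₂ _∨_ R≡false C≡false)

    not-dominating : ¬ IsKPowerDominating G₀ k S
    not-dominating dominating =
      let (t , observed) = all-observed dominating
          (z , z∉U) = vertex-outside-U
      in case trans (sym (observed⊆U t z (observed z))) z∉U of λ ()

  lower-bound : ∀ k S → IsKPowerDominating G₀ k S → a ≤ (k + 1) + ∣ S ∣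
  lower-bound k S dominating with a ℕ.≤? (k + 1) + ∣ S ∣
  ... | yes bound = bound
  ... | no ¬bound = ⊥-elim (LowerBound.not-dominating k S (ℕ.≰⇒> ¬bound) dominating)

  module UpperBound (k m : ℕ) (1≤k : 1 ≤ k) (1≤m : 1 ≤ m) (m+k≡ : m + k ≡ suc (suc b)) where

    -- Index 0 carries the deleted edge; D = {1, …, m} indexes the diagonal of the
    -- dominating set and E = {m + 1, …, a − 1} the remaining k lines.
    D E : Fin a → Bool
    D zero = false
    D (suc i) = toℕ i <ᵇ m
    E zero = false
    E (suc i) = not (toℕ i <ᵇ m)

    count-D : count D ≡ m
    count-D = count-<ᵇ m (subst (m ≤_) m+k≡ (ℕ.m≤m+n m k))

    count-E : count E ≡ k
    count-E = ℕ.+-cancelˡ-≡ m (count E) k (begin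
      m + count E                                         ≡⟨ cong (_+ count E) count-D ⟨
      count D + count E                                   ≡⟨ count+count-not (λ i → toℕ i <ᵇ m) ⟩
      suc (suc b)                                         ≡⟨ m+k≡ ⟨
      m + k                                               ∎)
      where open ≡-Reasoning

    1∈D : D (suc zero) ≡ true
    1∈D = T⇒≡ (ℕ.<⇒<ᵇ 1≤m)

    D⇒≢0 : ∀ {i} → D i ≡ true → i ≢ zero
    D⇒≢0 {suc _} _ ()

    E-if : ∀ i → i ≢ zero → D i ≡ false → E i ≡ true
    E-if zero i≢0 _ = contradiction refl i≢0
    E-if (suc i) _ i∉D = cong not i∉D

    onDiagonal : V → Bool
    onDiagonal z = D (row z) ∧ eqᵇ (row z) (col z)

    S : Subset (a * a)
    S = tabulate onDiagonal

    onDiagonal-⟨⟩ : ∀ g h → onDiagonal ⟨ g , h ⟩ ≡ D g ∧ eqᵇ g h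
    onDiagonal-⟨⟩ g h = cong₂ (λ g′ h′ → D g′ ∧ eqᵇ g′ h′) (row-⟨⟩ g h) (col-⟨⟩ g h)

    ∣S∣≡m : ∣ S ∣ ≡ m
    ∣S∣≡m = begin
      ∣ S ∣                                          ≡⟨ ∣tabulate∣≡count onDiagonal ⟩
      count onDiagonal                               ≡⟨ count-combine {a} {a} onDiagonal ⟩
      ∑[ g < a ] count (λ h → onDiagonal ⟨ g , h ⟩)   ≡⟨ sum-cong-≗ (λ g → trans (count-cong (onDiagonal-⟨⟩ g))
                                                                                (count-diagonal g (D g))) ⟩
      ∑[ g < a ] ind (D g)                           ≡⟨ count-D ⟩
      m                                              ∎
      where
      open ≡-Reasoning
      count-diagonal : ∀ g d → count (λ h → d ∧ eqᵇ g h) ≡ ind d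
      count-diagonal g false = count-zero (λ h → false ∧ eqᵇ g h) λ _ → refl
      count-diagonal g true = count-eqᵇ g

    diagonal∈S : ∀ g → D g ≡ true → lookup S ⟨ g , g ⟩ ≡ true
    diagonal∈S g g∈D = trans (lookup∘tabulate onDiagonal ⟨ g , g ⟩)
      (trans (onDiagonal-⟨⟩ g g) (cong₂ _∧_ g∈D (eqᵇ-refl g)))

    row∈D⇒off-edge : ∀ {x y} → D (row x) ≡ true → ¬ Deleted x y
    row∈D⇒off-edge row∈D deleted = D⇒≢0 row∈D (Deleted⇒row≡0 deleted)

    row₀∖u₀ : V → Bool
    row₀∖u₀ z = eqᵇ (row z) zero ∧ not (eqᵇ (col z) zero)

    A₀ A₁ A₂ : V → Bool
    A₀ z = D (row z) ∨ D (col z)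
    A₁ z = A₀ z ∨ row₀∖u₀ z
    A₂ z = D (row z) ∨ not (eqᵇ (col z) zero)

    ∉A₀ : ∀ z → not (A₀ z) ≡ true → D (row z) ≡ false × D (col z) ≡ false
    ∉A₀ z p = let q = not-true⇒false p in ∨-conicalˡ (D (row z)) (D (col z)) q , ∨-conicalʳ (D (row z)) (D (col z)) q

    ∉A₁ : ∀ z → not (A₁ z) ≡ true → not (A₀ z) ≡ true × row₀∖u₀ z ≡ false
    ∉A₁ z p = let q = not-true⇒false p in
      cong not (∨-conicalˡ (A₀ z) (row₀∖u₀ z) q) , ∨-conicalʳ (A₀ z) (row₀∖u₀ z) q

    diagonal-observes : ∀ g w → D g ≡ true → row w ≡ g ⊎ col w ≡ g → lookup (𝒫 G₀ k 0 S) w ≡ true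
    diagonal-observes g w g∈D on-line = ∈N[]ˢ⁺ S ⟨ g , g ⟩ w (diagonal∈S g g∈D)
      (N₀⁺ ⟨ g , g ⟩ w ([ (λ r → inj₁ (trans (row-⟨⟩ g g) (sym r))) , (λ c → inj₂ (trans (col-⟨⟩ g g) (sym c))) ]′ on-line)
        (row∈D⇒off-edge (trans (cong D (row-⟨⟩ g g)) g∈D)))

    A₀⊆𝒫₀ : A₀ ⊆ᵇ lookup (𝒫 G₀ k 0 S)
    A₀⊆𝒫₀ = ∨-⊆ᵇ {f = D ∘ row} {g = D ∘ col}
      (λ w row∈D → diagonal-observes (row w) w row∈D (inj₁ refl))
      (λ w col∈D → diagonal-observes (col w) w col∈D (inj₂ refl))

    -- v₀ forces row 0: its unobserved neighbours are the k vertices ⟨0 , h⟩ with h ∈ E.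
    row₀⊆𝒫₁ : ∀ w → row w ≡ zero → col w ≢ zero → lookup (𝒫 G₀ k 1 S) w ≡ true
    row₀⊆𝒫₁ w row≡0 col≢0 = forces (𝒫 G₀ k 0 S) A₀ A₀⊆𝒫₀ v₀ w 1∈D few w∈Nv₀
      where
      unobserved-in-E : ∀ z → Nᵇ v₀ z ∧ not (A₀ z) ≡ true → row z ≡ zero × E (col z) ≡ true
      unobserved-in-E z p =
        let (z∈N , z∉A₀) = ∧-true⁻ (Nᵇ v₀ z) p
            col∉D : D (col z) ≡ false
            col∉D = proj₂ (∉A₀ z z∉A₀)
            col≢0′ : row v₀ ≡ row z → col z ≢ zero
            col≢0′ row≡ col≡0 = case trans (sym z∈N)
              (trans (cong (Nᵇ v₀) (coords-injective {z} {u₀} (sym row≡) col≡0)) v₀-u₀-non-adjacent) of λ ()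
        in [ (λ row≡ → sym row≡ , E-if (col z) (col≢0′ row≡) col∉D)
           , (λ col≡1 → ⊥-elim (case trans (sym col∉D) (trans (cong D (sym col≡1)) 1∈D) of λ ())) ]′
           (N₀⁻ v₀ z z∈N)
      few : ∣N[ v₀ ]∖ A₀ ∣ ≤ k
      few = ℕ.≤-trans (count-in-row (λ z → Nᵇ v₀ z ∧ not (A₀ z)) zero E unobserved-in-E) (ℕ.≤-reflexive count-E)
      w∈Nv₀ : Nᵇ v₀ w ≡ true
      w∈Nv₀ = N₀⁺ v₀ w (inj₁ (sym row≡0)) λ
        { (inj₁ (v₀≡u₀ , _)) → u₀≢v₀ (sym v₀≡u₀)
        ; (inj₂ (_ , w≡u₀)) → col≢0 (cong col w≡u₀) }

    A₁⊆𝒫₁ : A₁ ⊆ᵇ lookup (𝒫 G₀ k 1 S)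
    A₁⊆𝒫₁ = ∨-⊆ᵇ {f = A₀} {g = row₀∖u₀} (λ z → 𝒫-mono k S 0 z ∘ A₀⊆𝒫₀ z) λ z p →
      let (row≡0 , col≢0) = ∧-true⁻ (eqᵇ (row z) zero) p in row₀⊆𝒫₁ z (eqᵇ⇒≡ row≡0) (not-eqᵇ⇒≢ col≢0)

    -- ⟨1 , h⟩ forces column h ≠ 0: its unobserved neighbours are the k vertices ⟨g , h⟩ with g ∈ E.
    col≢0⊆𝒫₂ : ∀ w → col w ≢ zero → lookup (𝒫 G₀ k 2 S) w ≡ true
    col≢0⊆𝒫₂ w col≢0 = forces (𝒫 G₀ k 1 S) A₁ A₁⊆𝒫₁ u w u∈A₁ few w∈Nu
      where
      u : V
      u = ⟨ suc zero , col w ⟩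
      row-u∈D : D (row u) ≡ true
      row-u∈D = trans (cong D (row-⟨⟩ (suc zero) (col w))) 1∈D
      u∈A₁ : A₁ u ≡ true
      u∈A₁ = cong (λ d → (d ∨ D (col u)) ∨ row₀∖u₀ u) row-u∈D
      unobserved-in-E : ∀ z → Nᵇ u z ∧ not (A₁ z) ≡ true → col z ≡ col w × E (row z) ≡ true
      unobserved-in-E z p =
        let (z∈N , z∉A₁) = ∧-true⁻ (Nᵇ u z) p
            (z∉A₀ , z∉row₀) = ∉A₁ z z∉A₁
            row∉D : D (row z) ≡ false
            row∉D = proj₁ (∉A₀ z z∉A₀)
            row≢0 : col z ≡ col w → row z ≢ zero
            row≢0 col≡ row≡0 = case trans (sym z∉row₀)
              (cong₂ _∧_ (cong (λ g → eqᵇ g zero) row≡0) (cong not (¬-not (col≢0 ∘ trans (sym col≡) ∘ eqᵇ⇒≡)))) of λ ()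
        in [ (λ same-row → ⊥-elim (case trans (sym row∉D) (trans (cong D (sym same-row)) row-u∈D) of λ ()))
           , (λ same-col → let col≡ = trans (sym same-col) (col-⟨⟩ (suc zero) (col w)) in
                           col≡ , E-if (row z) (row≢0 col≡) row∉D) ]′
           (N₀⁻ u z z∈N)
      few : ∣N[ u ]∖ A₁ ∣ ≤ k
      few = ℕ.≤-trans (count-in-col (λ z → Nᵇ u z ∧ not (A₁ z)) (col w) E unobserved-in-E) (ℕ.≤-reflexive count-E)
      w∈Nu : Nᵇ u w ≡ true
      w∈Nu = N₀⁺ u w (inj₂ (col-⟨⟩ (suc zero) (col w))) (row∈D⇒off-edge row-u∈D)

    A₂⊆𝒫₂ : A₂ ⊆ᵇ lookup (𝒫 G₀ k 2 S)
    A₂⊆𝒫₂ = ∨-⊆ᵇ {f = D ∘ row} {g = λ z → not (eqᵇ (col z) zero)}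
      (λ z row∈D → 𝒫-mono k S 1 z (𝒫-mono k S 0 z (A₀⊆𝒫₀ z (cong (_∨ D (col z)) row∈D))))
      (λ z col≢0 → col≢0⊆𝒫₂ z (not-eqᵇ⇒≢ col≢0))

    col≡2⇒∈A₂ : ∀ z → col z ≡ suc (suc zero) → A₂ z ≡ true
    col≡2⇒∈A₂ z col≡2 = trans (cong (λ c → D (row z) ∨ not (eqᵇ c zero)) col≡2) (∨-zeroʳ (D (row z)))

    -- ⟨g , 2⟩ forces row g: only ⟨g , 0⟩ can still be unobserved.
    all⊆𝒫₃ : ∀ w → lookup (𝒫 G₀ k 3 S) w ≡ true
    all⊆𝒫₃ w = forces (𝒫 G₀ k 2 S) A₂ A₂⊆𝒫₂ u w (col≡2⇒∈A₂ u col-u≡2) few w∈Nu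
      where
      u : V
      u = ⟨ row w , suc (suc zero) ⟩
      col-u≡2 : col u ≡ suc (suc zero)
      col-u≡2 = col-⟨⟩ (row w) (suc (suc zero))
      unobserved-at : ∀ z → Nᵇ u z ∧ not (A₂ z) ≡ true → row z ≡ row w × col z ≡ zero
      unobserved-at z p =
        let (z∈N , z∉A₂) = ∧-true⁻ (Nᵇ u z) p
            col≡0 : col z ≡ zero
            col≡0 = eqᵇ⇒≡ (trans (sym (not-involutive (eqᵇ (col z) zero)))
              (cong not (∨-conicalʳ (D (row z)) (not (eqᵇ (col z) zero)) (not-true⇒false z∉A₂))))
        in [ (λ same-row → trans (sym same-row) (row-⟨⟩ (row w) (suc (suc zero))) , col≡0)
           , (λ same-col → ⊥-elim (case trans (sym z∉A₂)
                 (cong not (col≡2⇒∈A₂ z (trans (sym same-col) col-u≡2))) of λ ())) ]′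
           (N₀⁻ u z z∈N)
      few : ∣N[ u ]∖ A₂ ∣ ≤ k
      few = ℕ.≤-trans (count≤1 (λ z → Nᵇ u z ∧ not (A₂ z)) λ x y px py →
        let (rx , cx) = unobserved-at x px ; (ry , cy) = unobserved-at y py in
        coords-injective (trans rx (sym ry)) (trans cx (sym cy))) 1≤k
      w∈Nu : Nᵇ u w ≡ true
      w∈Nu = N₀⁺ u w (inj₁ (row-⟨⟩ (row w) (suc (suc zero)))) λ deleted → case Deleted⇒col≤1 deleted of λ
        { (inj₁ col≡0) → case trans (sym col-u≡2) col≡0 of λ ()
        ; (inj₂ col≡1) → case trans (sym col-u≡2) col≡1 of λ () }

    dominating : IsKPowerDominating G₀ k S
    dominating = 3 , all-inside⇒≡⊤ (𝒫 G₀ k 3 S) all⊆𝒫₃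

  γ-G₀ : ∀ k m → 1 ≤ k → 1 ≤ m → m + k ≡ suc (suc b) → PowerDominationNumberIs G₀ k m
  γ-G₀ k m 1≤k 1≤m m+k≡ = (S , dominating , ∣S∣≡m) ,
    λ S′ S′-dominating → ℕ.+-cancelˡ-≤ (k + 1) m ∣ S′ ∣
      (subst (_≤ (k + 1) + ∣ S′ ∣) a≡ (lower-bound k S′ S′-dominating))
    where
    open UpperBound k m 1≤k 1≤m m+k≡
    a≡ : a ≡ (k + 1) + m
    a≡ = begin
      suc (suc (suc b))  ≡⟨ cong suc m+k≡ ⟨
      suc (m + k)        ≡⟨ cong suc (ℕ.+-comm m k) ⟩
      suc (k + m)        ≡⟨ ℕ.+-suc k m ⟨
      k + suc m          ≡⟨ ℕ.+-assoc k 1 m ⟨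
      (k + 1) + m        ∎
      where open ≡-Reasoning

mainTheorem8 : (k a : ℕ) → 1 ≤ k → k + 2 ≤ a →
    (e : Edge (K a □ K a)) →
    PowerDominationNumberIs ((K a □ K a) ─ e) k (a ∸ k ∸ 1)
mainTheorem8 k a 1≤k k+2≤a e with ℕ.≤-trans (ℕ.+-monoˡ-≤ 2 1≤k) k+2≤a
... | s≤s (s≤s (s≤s {n = b} _)) =
  RookEdge.γ-edge-invariant (suc b) k m e (DeletedEdge.γ-G₀ b k m 1≤k 1≤m m+k≡)
  where
  m : ℕ
  m = suc (suc (suc b)) ∸ k ∸ 1
  k≤1+b : k ≤ suc b
  k≤1+b = ℕ.+-cancelˡ-≤ 2 k (suc b) (subst (_≤ suc (suc (suc b))) (ℕ.+-comm k 2) k+2≤a)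
  m≡ : m ≡ suc (suc b) ∸ k
  m≡ = trans (ℕ.∸-+-assoc (suc (suc (suc b))) k 1) (cong (suc (suc (suc b)) ∸_) (ℕ.+-comm k 1))
  m+k≡ : m + k ≡ suc (suc b)
  m+k≡ = trans (cong (_+ k) m≡) (ℕ.m∸n+n≡m (ℕ.m≤n⇒m≤1+n k≤1+b))
  1≤m : 1 ≤ m
  1≤m = subst (1 ≤_) (sym m≡) (ℕ.m<n⇒0<n∸m (s≤s k≤1+b))
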